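{- Let $\Gamma\Rightarrow\Delta$ be a sequent of propositional Łukasiewicz logic in which every formula is atomic (a propositional variable or $\bot$). If $\Gamma\Rightarrow\Delta$ is valid, then it is derivable in GŁ.
   Context: Propositional formulas are built from propositional variables and $\bot$ using $\to$. An interpretation $v$ assigns each propositional variable a value in $[0,1]$, with $v(\bot)=1$ and $v(A\to B)=\max(v(B)-v(A),0)$. A sequent $\Gamma\Rightarrow\Delta$ is a pair of finite multisets of formulas; $v(\Gamma\Rightarrow\Delta)=\sum_{A\in\Delta}v(A)-\sum_{B\in\Gamma}v(B)$ (ordinary sums with multiplicity); it is valid if $v(\Gamma\Rightarrow\Delta)\le0$ for every interpretation $v$. Hypersequents are finite multisets of sequents, written with $\mid$. GŁ ($\mathcal{G}$ an arbitrary, possibly empty, side hypersequent): initial hypersequents $A\Rightarrow A$, the empty sequent $\Rightarrow$, and $\bot\Rightarrow A$; (ec) $\mathcal{G}\mid S\mid S\,/\,\mathcal{G}\mid S$; (ew) $\mathcal{G}\mid\Gamma\Rightarrow\Delta\,/\,\mathcal{G}\mid\Gamma\Rightarrow\Delta\mid\Gamma'\Rightarrow\Delta'$; (split) $\mathcal{G}\mid\Gamma_0,\Gamma_1\Rightarrow\Delta_0,\Delta_1\,/\,\mathcal{G}\mid\Gamma_0\Rightarrow\Delta_0\mid\Gamma_1\Rightarrow\Delta_1$; (mix) $\mathcal{G}\mid\Gamma_0\Rightarrow\Delta_0$ and $\mathcal{G}\mid\Gamma_1\Rightarrow\Delta_1\,/\,\mathcal{G}\mid\Gamma_0,\Gamma_1\Rightarrow\Delta_0,\Delta_1$;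 (wl) $\mathcal{G}\mid\Gamma\Rightarrow\Delta\,/\,\mathcal{G}\mid\Gamma,A\Rightarrow\Delta$; ($\to\Rightarrow$) $\mathcal{G}\mid\Gamma,B\Rightarrow A,\Delta\mid\Gamma\Rightarrow\Delta\,/\,\mathcal{G}\mid\Gamma,A\to B\Rightarrow\Delta$; ($\Rightarrow\to$) $\mathcal{G}\mid\Gamma,A\Rightarrow B,\Delta$ and $\mathcal{G}\mid\Gamma\Rightarrow\Delta\,/\,\mathcal{G}\mid\Gamma\Rightarrow A\to B,\Delta$. -}

module Defs where

open import Data.Nat using (ℕ)
open import Data.List using (List; []; _∷_; _++_)
open import Data.List.Relation.Binary.Permutation.Propositional using (_↭_)
open import Data.Product using (_×_; _,_)
open import Data.Rational using (ℚ; 0ℚ; 1ℚ; _+_; _-_; _⊔_; _≤_)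
open import Relation.Binary.PropositionalEquality using (_≡_)

infixr 5 _⟶_
data Formula : Set where
  var : ℕ → Formula
  ⊥f  : Formula
  _⟶_ : Formula → Formula → Formula

data Atomic : Formula → Set where
  atVar : ∀ p → Atomic (var p)
  atBot : Atomic ⊥f

Assignment : Set
Assignment = ℕ → ℚ

InUnit : Assignment → Set
InUnit v = ∀ p → (0ℚ ≤ v p) × (v p ≤ 1ℚ)

eval : Assignment → Formula → ℚ
eval v (var p) = v p
eval v ⊥f = 1ℚ
eval v (A ⟶ B) = (eval v B - eval v A) ⊔ 0ℚ

sumF : Assignment → List Formula → ℚ
sumF v [] = 0ℚ
sumF v (A ∷ Γ) = eval v A + sumF v Γ

Sequent : Set
Sequent = List Formula × List Formula

evalSeq : Assignment → Sequent → ℚ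
evalSeq v (Γ , Δ) = sumF v Δ - sumF v Γ

Valid : Sequent → Set
Valid S = ∀ v → InUnit v → evalSeq v S ≤ 0ℚ

Hypersequent : Set
Hypersequent = List Sequent

-- The calculus GŁ. Multisets are modelled by lists together with
-- structural rules closing derivability under permutations.
data GŁ : Hypersequent → Set where
  perm-H : ∀ {H H'} → GŁ H → H ↭ H' → GŁ H'
  perm-S : ∀ {Γ Γ' Δ Δ' G} → GŁ ((Γ , Δ) ∷ G) → Γ ↭ Γ' → Δ ↭ Δ' → GŁ ((Γ' , Δ') ∷ G)
  ax-id  : ∀ A → GŁ ((A ∷ [] , A ∷ []) ∷ [])
  ax-emp : GŁ (([] , []) ∷ [])
  ax-bot : ∀ A → GŁ ((⊥f ∷ [] , A ∷ []) ∷ [])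
  ec    : ∀ {G S} → GŁ (S ∷ S ∷ G) → GŁ (S ∷ G)
  ew    : ∀ {G S S'} → GŁ (S ∷ G) → GŁ (S ∷ S' ∷ G)
  split : ∀ {G Γ₀ Γ₁ Δ₀ Δ₁} → GŁ ((Γ₀ ++ Γ₁ , Δ₀ ++ Δ₁) ∷ G) → GŁ ((Γ₀ , Δ₀) ∷ (Γ₁ , Δ₁) ∷ G)
  mix   : ∀ {G Γ₀ Γ₁ Δ₀ Δ₁} → GŁ ((Γ₀ , Δ₀) ∷ G) → GŁ ((Γ₁ , Δ₁) ∷ G) → GŁ ((Γ₀ ++ Γ₁ , Δ₀ ++ Δ₁) ∷ G)
  wl    : ∀ {G Γ Δ} A → GŁ ((Γ , Δ) ∷ G) → GŁ ((A ∷ Γ , Δ) ∷ G)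
  →⇒ : ∀ {G Γ Δ} A B → GŁ ((B ∷ Γ , A ∷ Δ) ∷ (Γ , Δ) ∷ G) → GŁ (((A ⟶ B) ∷ Γ , Δ) ∷ G)
  ⇒→ : ∀ {G Γ Δ} A B → GŁ ((A ∷ Γ , B ∷ Δ) ∷ G) → GŁ ((Γ , Δ) ∷ G) → GŁ ((Γ , (A ⟶ B) ∷ Δ) ∷ G)

{-# OPTIONS --safe #-}

-- Induction on the succedent.  Its first atom A is paired with an occurrence of A
-- (axiom A ⇒ A) or of ⊥ (axiom ⊥ ⇒ A) in the antecedent, the rest being derived by
-- induction and joined by mix.  If A does not occur on the left, then setting A to 1
-- shows that the sequent remains valid with A replaced by ⊥; and ⊥ must then occur on
-- the left, since otherwise the interpretation that is 0 everywhere refutes it.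

module Submission where

open import Defs
open import Data.Nat as ℕ using (ℕ)
open import Data.List using (List; []; _∷_; _++_)
open import Data.List.Relation.Unary.All as All using (All; []; _∷_)
open import Data.List.Relation.Unary.Any using (here; there)
open import Data.List.Membership.Propositional using (_∈_; _∉_)
open import Data.List.Membership.Propositional.Properties using (∈-∃++)
open import Data.List.Relation.Binary.Permutation.Propositional as ↭ using (_↭_; ↭-refl; ↭-sym)
open import Data.List.Relation.Binary.Permutation.Propositional.Properties using (All-resp-↭; shift)
open import Data.Product using (_,_; _×_; ∃; proj₁; proj₂)
open import Data.Empty using (⊥-elim)
open import Data.Rational using (0ℚ; 1ℚ; _+_; _-_; -_; _≤_)
open import Data.Rational.Properties
  using ( ≤-refl; <-irrefl; +-identityˡ; +-inverseʳ; +-mono-≤; +-monoˡ-≤; +-monoʳ-≤; p≤q⊔p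
        ; nonNegative⁻¹; positive⁻¹; +-0-group; +-0-commutativeMonoid; module ≤-Reasoning)
open import Algebra.Bundles using (CommutativeMonoid)
open import Algebra.Properties.Group +-0-group using (\\-leftDividesʳ; //-rightDividesˡ)
open import Algebra.Properties.CommutativeSemigroup
  (CommutativeMonoid.commutativeSemigroup +-0-commutativeMonoid) using (x∙yz≈y∙xz)
open import Relation.Nullary using (yes; no)
open import Relation.Nullary.Decidable using (map′; _×-dec_)
open import Relation.Binary.Definitions using (DecidableEquality)
open import Relation.Binary.PropositionalEquality
  using (_≡_; _≢_; refl; sym; trans; cong; cong₂; subst; subst₂; module ≡-Reasoning)

p-q≤0⇒p≤q : ∀ {p q} → p - q ≤ 0ℚ → p ≤ q
p-q≤0⇒p≤q {p} {q} p-q≤0 =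
  subst₂ _≤_ (//-rightDividesˡ q p) (+-identityˡ q) (+-monoˡ-≤ q p-q≤0)

p≤q⇒p-q≤0 : ∀ {p q} → p ≤ q → p - q ≤ 0ℚ
p≤q⇒p-q≤0 {p} {q} p≤q = subst (p - q ≤_) (+-inverseʳ q) (+-monoˡ-≤ (- q) p≤q)

+-cancelˡ-≤ : ∀ r {p q} → r + p ≤ r + q → p ≤ q
+-cancelˡ-≤ r {p} {q} r+p≤r+q =
  subst₂ _≤_ (\\-leftDividesʳ r p) (\\-leftDividesʳ r q) (+-monoʳ-≤ (- r) r+p≤r+q)

_≟_ : DecidableEquality Formula
var p ≟ var q = map′ (cong var) (λ { refl → refl }) (p ℕ.≟ q)
var _ ≟ ⊥f = no λ ()
var _ ≟ (_ ⟶ _) = no λ ()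
⊥f ≟ var _ = no λ ()
⊥f ≟ ⊥f = yes refl
⊥f ≟ (_ ⟶ _) = no λ ()
(_ ⟶ _) ≟ var _ = no λ ()
(_ ⟶ _) ≟ ⊥f = no λ ()
(A ⟶ B) ≟ (C ⟶ D) =
  map′ (λ { (refl , refl) → refl }) (λ { refl → refl , refl }) ((A ≟ C) ×-dec (B ≟ D))

open import Data.List.Membership.DecPropositional _≟_ using (_∈?_)

∈⇒↭∷ : ∀ {a} {A : Set a} {x : A} {xs} → x ∈ xs → ∃ λ ys → xs ↭ x ∷ ys
∈⇒↭∷ {x = x} x∈xs with ys , zs , refl ← ∈-∃++ x∈xs = ys ++ zs , shift x ys zs

sumF-↭ : ∀ v {Γ Γ′} → Γ ↭ Γ′ → sumF v Γ ≡ sumF v Γ′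
sumF-↭ v ↭.refl = refl
sumF-↭ v (↭.prep A p) = cong (eval v A +_) (sumF-↭ v p)
sumF-↭ v {A ∷ B ∷ Γ} {_ ∷ _ ∷ Γ′} (↭.swap _ _ p) = begin
  eval v A + (eval v B + sumF v Γ)  ≡⟨ x∙yz≈y∙xz (eval v A) (eval v B) (sumF v Γ) ⟩
  eval v B + (eval v A + sumF v Γ)  ≡⟨ cong (λ s → eval v B + (eval v A + s)) (sumF-↭ v p) ⟩
  eval v B + (eval v A + sumF v Γ′) ∎
  where open ≡-Reasoning
sumF-↭ v (↭.trans p q) = trans (sumF-↭ v p) (sumF-↭ v q)

eval-nonneg : ∀ {v} → InUnit v → ∀ A → 0ℚ ≤ eval v A
eval-nonneg u (var p) = proj₁ (u p)
eval-nonneg u ⊥f = nonNegative⁻¹ 1ℚ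
eval-nonneg {v} u (A ⟶ B) = p≤q⊔p (eval v B - eval v A) 0ℚ

sumF-nonneg : ∀ {v} → InUnit v → ∀ Γ → 0ℚ ≤ sumF v Γ
sumF-nonneg u [] = ≤-refl
sumF-nonneg u (A ∷ Γ) = +-mono-≤ (eval-nonneg u A) (sumF-nonneg u Γ)

sumF-mono : ∀ {v w Γ} → All (λ A → eval v A ≤ eval w A) Γ → sumF v Γ ≤ sumF w Γ
sumF-mono [] = ≤-refl
sumF-mono (A≤ ∷ Γ≤) = +-mono-≤ A≤ (sumF-mono Γ≤)

sumF-cong : ∀ {v w Γ} → All (λ A → eval v A ≡ eval w A) Γ → sumF v Γ ≡ sumF w Γ
sumF-cong [] = refl
sumF-cong (A≡ ∷ Γ≡) = cong₂ _+_ A≡ (sumF-cong Γ≡)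

sumF-0-⊥∉ : ∀ {Γ} → All Atomic Γ → ⊥f ∉ Γ → sumF (λ _ → 0ℚ) Γ ≡ 0ℚ
sumF-0-⊥∉ [] _ = refl
sumF-0-⊥∉ (atVar p ∷ atΓ) ⊥∉Γ = trans (+-identityˡ _) (sumF-0-⊥∉ atΓ (λ ⊥∈ → ⊥∉Γ (there ⊥∈)))
sumF-0-⊥∉ (atBot ∷ _) ⊥∉Γ = ⊥-elim (⊥∉Γ (here refl))

raise : ℕ → Assignment → Assignment
raise q v p with p ℕ.≟ q
... | yes _ = 1ℚ
... | no _ = v p

raise-self : ∀ q v → raise q v q ≡ 1ℚ
raise-self q v with q ℕ.≟ q
... | yes _ = refl
... | no q≢q = ⊥-elim (q≢q refl)

raise-InUnit : ∀ {q v} → InUnit v → InUnit (raise q v)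
raise-InUnit {q} u p with p ℕ.≟ q
... | yes _ = nonNegative⁻¹ 1ℚ , ≤-refl
... | no _ = u p

eval-raise-≥ : ∀ {q v A} → InUnit v → Atomic A → eval v A ≤ eval (raise q v) A
eval-raise-≥ {q} u (atVar p) with p ℕ.≟ q
... | yes _ = proj₂ (u p)
... | no _ = ≤-refl
eval-raise-≥ u atBot = ≤-refl

eval-raise-≢ : ∀ {q v A} → Atomic A → A ≢ var q → eval (raise q v) A ≡ eval v A
eval-raise-≢ {q} (atVar p) p≢q with p ℕ.≟ q
... | yes refl = ⊥-elim (p≢q refl)
... | no _ = refl
eval-raise-≢ atBot _ = refl

valid⇒≤ : ∀ {Γ Δ} → Valid (Γ , Δ) → ∀ {v} → InUnit v → sumF v Δ ≤ sumF v Γ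
valid⇒≤ valid u = p-q≤0⇒p≤q (valid _ u)

≤⇒valid : ∀ {Γ Δ} → (∀ {v} → InUnit v → sumF v Δ ≤ sumF v Γ) → Valid (Γ , Δ)
≤⇒valid Δ≤Γ v u = p≤q⇒p-q≤0 (Δ≤Γ u)

valid-drop : ∀ {Γ Γ′ A Δ} → Γ ↭ A ∷ Γ′ → Valid (Γ , A ∷ Δ) → Valid (Γ′ , Δ)
valid-drop {Γ} {Γ′} {A} {Δ} Γ↭ valid = ≤⇒valid {Γ′} {Δ} λ {v} u →
  +-cancelˡ-≤ (eval v A) (subst (_ ≤_) (sumF-↭ v Γ↭) (valid⇒≤ {Γ} {A ∷ Δ} valid u))

valid-∉⇒valid-⊥ : ∀ {A Γ Δ} → Atomic A → All Atomic Γ → All Atomic Δ → A ∉ Γ →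
  Valid (Γ , A ∷ Δ) → Valid (Γ , ⊥f ∷ Δ)
valid-∉⇒valid-⊥ atBot _ _ _ valid = valid
valid-∉⇒valid-⊥ {Γ = Γ} {Δ} (atVar q) atΓ atΔ q∉Γ valid = ≤⇒valid {Γ} {⊥f ∷ Δ} λ {v} u →
  let w = raise q v in begin
  1ℚ + sumF v Δ             ≤⟨ +-monoʳ-≤ 1ℚ (sumF-mono (All.map (eval-raise-≥ u) atΔ)) ⟩
  1ℚ + sumF w Δ             ≡⟨ cong (_+ sumF w Δ) (sym (raise-self q v)) ⟩
  w q + sumF w Δ            ≤⟨ valid⇒≤ {Γ} {var q ∷ Δ} valid (raise-InUnit u) ⟩
  sumF w Γ                  ≡⟨ sumF-cong (All.tabulate λ B∈Γ →
                                 eval-raise-≢ (All.lookup atΓ B∈Γ) λ { refl → q∉Γ B∈Γ }) ⟩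
  sumF v Γ                  ∎
  where open ≤-Reasoning

valid-⊥⇒⊥∈ : ∀ {Γ Δ} → All Atomic Γ → Valid (Γ , ⊥f ∷ Δ) → ⊥f ∈ Γ
valid-⊥⇒⊥∈ {Γ} {Δ} atΓ valid with ⊥f ∈? Γ
... | yes ⊥∈Γ = ⊥∈Γ
... | no ⊥∉Γ = ⊥-elim (<-irrefl refl (begin-strict
  0ℚ                    <⟨ positive⁻¹ 1ℚ ⟩
  1ℚ                    ≤⟨ +-monoʳ-≤ 1ℚ (sumF-nonneg u0 Δ) ⟩
  1ℚ + sumF v0 Δ        ≤⟨ valid⇒≤ {Γ} {⊥f ∷ Δ} valid u0 ⟩
  sumF v0 Γ             ≡⟨ sumF-0-⊥∉ atΓ ⊥∉Γ ⟩
  0ℚ                    ∎))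
  where
  open ≤-Reasoning
  v0 : Assignment
  v0 _ = 0ℚ
  u0 : InUnit v0
  u0 _ = ≤-refl , nonNegative⁻¹ 1ℚ

infix 4 ⊢_⇒_
⊢_⇒_ : List Formula → List Formula → Set
⊢ Γ ⇒ Δ = GŁ ((Γ , Δ) ∷ [])

⊢⇒[] : ∀ Γ → ⊢ Γ ⇒ []
⊢⇒[] [] = ax-emp
⊢⇒[] (A ∷ Γ) = wl A (⊢⇒[] Γ)

mix-↭ : ∀ {Γ Γ′ Δ A B} → Γ ↭ B ∷ Γ′ → ⊢ B ∷ [] ⇒ A ∷ [] → ⊢ Γ′ ⇒ Δ → ⊢ Γ ⇒ A ∷ Δ
mix-↭ Γ↭ ⊢B⇒A ⊢Γ′⇒Δ = perm-S (mix ⊢B⇒A ⊢Γ′⇒Δ) (↭-sym Γ↭) ↭-refl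

matching-atom : ∀ {A Γ Δ} → Atomic A → All Atomic Γ → All Atomic Δ → Valid (Γ , A ∷ Δ) →
  ∃ λ B → B ∈ Γ × ⊢ B ∷ [] ⇒ A ∷ [] × Valid (Γ , B ∷ Δ)
matching-atom {A} {Γ} {Δ} atA atΓ atΔ valid with A ∈? Γ
... | yes A∈Γ = A , A∈Γ , ax-id A , valid
... | no A∉Γ = ⊥f , valid-⊥⇒⊥∈ {Δ = Δ} atΓ valid⊥ , ax-bot A , valid⊥
  where
  valid⊥ : Valid (Γ , ⊥f ∷ Δ)
  valid⊥ = valid-∉⇒valid-⊥ atA atΓ atΔ A∉Γ valid

mainTheorem6 : (Γ Δ : List Formula) → All Atomic Γ → All Atomic Δ →
    Valid (Γ , Δ) → GŁ ((Γ , Δ) ∷ [])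
mainTheorem6 Γ [] _ _ _ = ⊢⇒[] Γ
mainTheorem6 Γ (A ∷ Δ) atΓ (atA ∷ atΔ) valid
  with B , B∈Γ , ⊢B⇒A , validB ← matching-atom atA atΓ atΔ valid
  with Γ′ , Γ↭ ← ∈⇒↭∷ B∈Γ
  = mix-↭ Γ↭ ⊢B⇒A
      (mainTheorem6 Γ′ Δ (All.tail (All-resp-↭ Γ↭ atΓ)) atΔ (valid-drop {Δ = Δ} Γ↭ validB))
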